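{- Let $G=(V,E)$ be a finite simple bipartite graph with bipartition $V_1,V_2$, and let $G'=(V',E')$ be obtained from $G$ by adding a new vertex $v_1$ adjacent to every vertex of $V_1$, and a new vertex $v_0$ adjacent only to $v_1$. Let $(R,\sigma)$ be an assignment for $(G',v_0)$. Then: (1) if $\sigma(v_0)\neq\perp$, $G$ has a matching covering $V_1$ (obtainable from $(R,\sigma)$); (2) if $\sigma(v_0)=\perp$, there is a set $S\subseteq V_1$ with $|N_G(S)|<|S|$ (obtainable from $(R,\sigma)$).
   Context: For $U\subseteq V$, $N_G(U)$ is the set of vertices of $V\setminus U$ adjacent in $G$ to some vertex of $U$; $N_{G'}(v)$ is the set of neighbours of $v$ in $G'$. A matching covering $V_1$ is a set of pairwise disjoint edges of $G$ such that every vertex of $V_1$ lies in one of them. An assignment for $(G',v_0)$ is a pair $(R,\sigma)$ with $R\subseteq V'$, $v_0\in R$, and $\sigma:V'\to V'\cup\{\perp\}$ ($\perp$ a symbol not in $V'$) such that: (C1) for $v\in R$, if $\sigma(v)=u\in V'$ then $u\in N_{G'}(v)\cap R$ and $\sigma(u)=\perp$; (C2) for $v\in R$, if $\sigma(v)=\perp$ then for every $u\in N_{G'}(v)$ we have $u\in R$ and $\sigma(u)\neq\perp$; (C3) for $v\in R$ we have $|\sigma^{ -1}(v)|\le 1$, and $\sigma^{ -1}(v_0)=\emptyset$. -}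

module Defs where

open import Data.Nat using (ℕ; zero; suc; _<_)
open import Data.Fin using (Fin; zero; suc)
open import Data.Bool using (Bool; true; false; _∧_; _∨_; if_then_else_)
open import Data.Maybe using (Maybe; just; nothing)
open import Data.Vec using (Vec; lookup; tabulate)
open import Data.Fin.Subset using (Subset; inside; outside; _∈_)
open import Data.Product using (Σ; _×_; _,_)
open import Relation.Binary.PropositionalEquality using (_≡_; _≢_)

-- A finite simple bipartite graph G with bipartition V₁ = Fin m, V₂ = Fin n
-- is given by its (Boolean) bipartite adjacency E : Fin m → Fin n → Bool:
-- E i j ≡ true iff the vertex i ∈ V₁ is adjacent to j ∈ V₂.
BipGraph : ℕ → ℕ → Set
BipGraph m n = Fin m → Fin n → Bool

anyFin : ∀ {m} → (Fin m → Bool) → Bool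
anyFin {zero}  f = false
anyFin {suc m} f = f zero ∨ anyFin (λ i → f (suc i))

-- N_G(S) for S ⊆ V₁: the vertices outside S adjacent to some vertex of S.
-- As G is bipartite these are exactly the vertices j ∈ V₂ adjacent to S.
nbhd : ∀ {m n} → BipGraph m n → Subset m → Subset n
nbhd {m} E S = tabulate (λ j → anyFin (λ i → lookup S i ∧ E i j))

record MatchingCovering {m n} (E : BipGraph m n) (M : Fin m → Fin n → Bool) : Set where
  field
    edges    : ∀ i j → M i j ≡ true → E i j ≡ true
    disjoint₁ : ∀ i j j′ → M i j ≡ true → M i j′ ≡ true → j ≡ j′
    disjoint₂ : ∀ i i′ j → M i j ≡ true → M i′ j ≡ true → i ≡ i′
    covers   : ∀ i → Σ (Fin n) (λ j → M i j ≡ true)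

data Vert (m n : ℕ) : Set where
  left  : Fin m → Vert m n
  right : Fin n → Vert m n
  v₁    : Vert m n
  v₀    : Vert m n

adj′ : ∀ {m n} → BipGraph m n → Vert m n → Vert m n → Bool
adj′ E (left i)  (right j) = E i j
adj′ E (right j) (left i)  = E i j
adj′ E (left i)  v₁        = true
adj′ E v₁        (left i)  = true
adj′ E v₀        v₁        = true
adj′ E v₁        v₀        = true
adj′ E _         _         = false

-- An assignment (R, σ) for (G', v₀). R ⊆ V' is a Boolean predicate,
-- σ : V' → V' ∪ {⊥} is modelled with Maybe (nothing = ⊥).
record IsAssignment {m n} (E : BipGraph m n)
                    (R : Vert m n → Bool) (σ : Vert m n → Maybe (Vert m n)) : Set where
  field
    v₀∈R : R v₀ ≡ true
    C1   : ∀ v u → R v ≡ true → σ v ≡ just u →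
           adj′ E v u ≡ true × R u ≡ true × σ u ≡ nothing
    C2   : ∀ v → R v ≡ true → σ v ≡ nothing →
           ∀ u → adj′ E v u ≡ true → R u ≡ true × σ u ≢ nothing
    C3   : ∀ v → R v ≡ true → ∀ u w → σ u ≡ just v → σ w ≡ just v → u ≡ w
    C3₀  : ∀ u → σ u ≢ just v₀

-- If σ v₀ ≠ ⊥ then σ v₀ = v₁ with σ v₁ = ⊥, so by (C2) every vertex of V₁ lies in R
-- and is sent by σ to a neighbour; it cannot be v₁, whose only preimage is v₀ by (C3),
-- so σ restricted to V₁ is a matching into V₂, injective by (C3).
-- If σ v₀ = ⊥ then σ v₁ = i₀ ∈ V₁ (not v₀, by (C3)). Let S be the set of i ∈ V₁ ∩ R
-- with σ i = ⊥; it contains i₀. By (C2) every j ∈ N_G(S) lies in R with σ j ≠ ⊥, and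
-- σ j ∈ S ∖ {i₀}, as i₀ already has the preimage v₁; by (C3) j ↦ σ j is injective, whence
-- |N_G(S)| ≤ |S| - 1.
module Submission where

open import Defs
open import Data.Nat as ℕ using (ℕ; _<_; _≤_; z≤n)
open import Data.Nat.Properties using (≤-<-trans)
open import Data.Fin using (Fin; zero; suc)
open import Data.Fin.Properties using (0≢1+n; suc-injective; _≟_)
open import Data.Bool using (Bool; true; false; _∧_)
open import Data.Maybe using (Maybe; just; nothing; is-nothing)
open import Data.Maybe.Properties using (just-injective)
open import Data.Vec using ([]; _∷_; lookup; tabulate; here; there)
open import Data.Vec.Properties using ([]=⇒lookup; lookup⇒[]=; lookup∘tabulate)
open import Data.Fin.Subset using (Subset; ∣_∣; _∈_; _-_; inside; outside)
open import Data.Fin.Subset.Properties using (x∈p∧x≢y⇒x∈p-y; x∈p⇒∣p-x∣<∣p∣)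
open import Data.Product using (Σ; _×_; _,_; proj₁; proj₂; ∃)
open import Data.Empty using (⊥-elim)
open import Relation.Nullary using (yes; no; does)
open import Relation.Binary.PropositionalEquality using (_≡_; _≢_; refl; sym; trans; cong; cong₂; subst)

∧≡true⇒× : ∀ {a b} → a ∧ b ≡ true → a ≡ true × b ≡ true
∧≡true⇒× {true} {true} refl = refl , refl

is-nothing⇒≡nothing : ∀ {A : Set} {x : Maybe A} → is-nothing x ≡ true → x ≡ nothing
is-nothing⇒≡nothing {x = nothing} refl = refl

anyFin⇒∃ : ∀ {m} {f : Fin m → Bool} → anyFin f ≡ true → ∃ λ i → f i ≡ true
anyFin⇒∃ {ℕ.suc m} {f} eq with f zero in f0
... | true  = zero , f0
... | false with anyFin⇒∃ eq
...   | i , fi = suc i , fi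

∈-tabulate⁻ : ∀ {k} {f : Fin k → Bool} {x} → x ∈ tabulate f → f x ≡ true
∈-tabulate⁻ {f = f} {x} x∈ = trans (sym (lookup∘tabulate f x)) ([]=⇒lookup x∈)

∈-tabulate⁺ : ∀ {k} {f : Fin k → Bool} {x} → f x ≡ true → x ∈ tabulate f
∈-tabulate⁺ {f = f} {x} fx = lookup⇒[]= x _ (trans (lookup∘tabulate f x) fx)

∈-nbhd⁻ : ∀ {m n} (E : BipGraph m n) (S : Subset m) {j} →
          j ∈ nbhd E S → ∃ λ i → i ∈ S × E i j ≡ true
∈-nbhd⁻ E S j∈N with anyFin⇒∃ (∈-tabulate⁻ j∈N)
... | i , Si∧Eij with ∧≡true⇒× Si∧Eij
...   | Si , Eij = i , lookup⇒[]= i S Si , Eij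

injectiveOn⇒∣p∣≤∣q∣ : ∀ {k l} {p : Subset k} {q : Subset l} (f : ∀ x → x ∈ p → Fin l) →
                       (∀ x x∈p → f x x∈p ∈ q) →
                       (∀ x y x∈p y∈p → f x x∈p ≡ f y y∈p → x ≡ y) →
                       ∣ p ∣ ≤ ∣ q ∣
injectiveOn⇒∣p∣≤∣q∣ {p = []} f f∈q f-inj = z≤n
injectiveOn⇒∣p∣≤∣q∣ {p = outside ∷ p} f f∈q f-inj =
  injectiveOn⇒∣p∣≤∣q∣ (λ x x∈p → f (suc x) (there x∈p)) (λ x x∈p → f∈q (suc x) (there x∈p))
    (λ x y x∈p y∈p eq → suc-injective (f-inj (suc x) (suc y) (there x∈p) (there y∈p) eq))
injectiveOn⇒∣p∣≤∣q∣ {p = inside ∷ p} {q} f f∈q f-inj =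
  ≤-<-trans (injectiveOn⇒∣p∣≤∣q∣ {q = q - f zero here} (λ x x∈p → f (suc x) (there x∈p)) f∈q-f₀
              (λ x y x∈p y∈p eq → suc-injective (f-inj (suc x) (suc y) (there x∈p) (there y∈p) eq)))
            (x∈p⇒∣p-x∣<∣p∣ (f∈q zero here))
  where
  f∈q-f₀ : ∀ x x∈p → f (suc x) (there x∈p) ∈ q - f zero here
  f∈q-f₀ x x∈p = x∈p∧x≢y⇒x∈p-y (f∈q (suc x) (there x∈p))
                   (λ eq → 0≢1+n (sym (f-inj (suc x) zero (there x∈p) here eq)))

isJustRight : ∀ {m n} → Maybe (Vert m n) → Fin n → Bool
isJustRight (just (right j′)) j = does (j′ ≟ j)
isJustRight _                 _ = false

isJustRight⇒≡ : ∀ {m n} (x : Maybe (Vert m n)) {j} → isJustRight x j ≡ true → x ≡ just (right j)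
isJustRight⇒≡ (just (right j′)) {j} eq with j′ ≟ j
isJustRight⇒≡ (just (right j′)) refl | yes refl = refl
isJustRight⇒≡ (just (right j′)) ()   | no _
isJustRight⇒≡ (just (left _))   ()
isJustRight⇒≡ (just v₁)         ()
isJustRight⇒≡ (just v₀)         ()
isJustRight⇒≡ nothing           ()

isJustRight-refl : ∀ {m n} (j : Fin n) → isJustRight {m} (just (right j)) j ≡ true
isJustRight-refl j with j ≟ j
... | yes _   = refl
... | no j≢j = ⊥-elim (j≢j refl)

right-injective : ∀ {m n} {j j′ : Fin n} → right {m} j ≡ right j′ → j ≡ j′
right-injective refl = refl

module Assignment {m n} (E : BipGraph m n) (R : Vert m n → Bool)
                  (σ : Vert m n → Maybe (Vert m n)) (A : IsAssignment E R σ) where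
  open IsAssignment A

  Unmatched : Vert m n → Set
  Unmatched v = R v ≡ true × σ v ≡ nothing

  partner : ∀ {v} → R v ≡ true → σ v ≢ nothing →
            ∃ λ u → σ v ≡ just u × adj′ E v u ≡ true × Unmatched u
  partner {v} Rv σv≢⊥ with σ v in σv
  ... | nothing = ⊥-elim (σv≢⊥ refl)
  ... | just u  = u , refl , C1 v u Rv σv

  module Covering (σv₀≢⊥ : σ v₀ ≢ nothing) where

    σv₀≡v₁ : σ v₀ ≡ just v₁
    σv₀≡v₁ with partner v₀∈R σv₀≢⊥
    ... | v₁      , σv₀ , _  , _ = σv₀
    ... | left _  , _   , () , _
    ... | right _ , _   , () , _
    ... | v₀      , _   , () , _

    v₁-unmatched : Unmatched v₁
    v₁-unmatched = proj₂ (C1 v₀ v₁ v₀∈R σv₀≡v₁)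

    left-matched-in-R : ∀ i → R (left i) ≡ true × σ (left i) ≢ nothing
    left-matched-in-R i = C2 v₁ (proj₁ v₁-unmatched) (proj₂ v₁-unmatched) (left i) refl

    left∈R : ∀ i → R (left i) ≡ true
    left∈R i = proj₁ (left-matched-in-R i)

    left-matched : ∀ i → ∃ λ j → σ (left i) ≡ just (right j)
    left-matched i with partner (left∈R i) (proj₂ (left-matched-in-R i))
    ... | right j , σi , _  , _ = j , σi
    ... | left _  , _  , () , _
    ... | v₀      , _  , () , _
    ... | v₁      , σi , _  , _ with C3 v₁ (proj₁ v₁-unmatched) (left i) v₀ σi σv₀≡v₁
    ...   | ()

    matching : Fin m → Fin n → Bool
    matching i j = isJustRight (σ (left i)) j

    matching⇒σ : ∀ {i j} → matching i j ≡ true → σ (left i) ≡ just (right j)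
    matching⇒σ {i} = isJustRight⇒≡ (σ (left i))

    isMatchingCovering : MatchingCovering E matching
    isMatchingCovering = record
      { edges     = λ i j Mij → proj₁ (C1 (left i) (right j) (left∈R i) (matching⇒σ Mij))
      ; disjoint₁ = λ i j j′ Mij Mij′ →
          right-injective (just-injective (trans (sym (matching⇒σ Mij)) (matching⇒σ Mij′)))
      ; disjoint₂ = λ i i′ j Mij Mi′j →
          let Rj = proj₁ (proj₂ (C1 (left i) (right j) (left∈R i) (matching⇒σ Mij))) in
          left-injective (C3 (right j) Rj (left i) (left i′) (matching⇒σ Mij) (matching⇒σ Mi′j))
      ; covers    = λ i → let (j , σi) = left-matched i in
          j , subst (λ x → isJustRight x j ≡ true) (sym σi) (isJustRight-refl {m} j)
      }
      where
      left-injective : ∀ {i i′ : Fin m} → left {m} {n} i ≡ left i′ → i ≡ i′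
      left-injective refl = refl

  module Deficiency (σv₀≡⊥ : σ v₀ ≡ nothing) where

    v₁-matched-in-R : R v₁ ≡ true × σ v₁ ≢ nothing
    v₁-matched-in-R = C2 v₀ v₀∈R σv₀≡⊥ v₁ refl

    v₁∈R : R v₁ ≡ true
    v₁∈R = proj₁ v₁-matched-in-R

    v₁-matched-left : ∃ λ i₀ → σ v₁ ≡ just (left i₀)
    v₁-matched-left with partner v₁∈R (proj₂ v₁-matched-in-R)
    ... | left i₀ , σv₁ , _  , _ = i₀ , σv₁
    ... | v₀      , σv₁ , _  , _ = ⊥-elim (C3₀ v₁ σv₁)
    ... | right _ , _   , () , _
    ... | v₁      , _   , () , _

    i₀ : Fin m
    i₀ = proj₁ v₁-matched-left

    i₀-unmatched : Unmatched (left i₀)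
    i₀-unmatched = proj₂ (C1 v₁ (left i₀) v₁∈R (proj₂ v₁-matched-left))

    S : Subset m
    S = tabulate (λ i → R (left i) ∧ is-nothing (σ (left i)))

    ∈S⁻ : ∀ {i} → i ∈ S → Unmatched (left i)
    ∈S⁻ i∈S with ∧≡true⇒× (∈-tabulate⁻ i∈S)
    ... | Ri , σi = Ri , is-nothing⇒≡nothing σi

    ∈S⁺ : ∀ {i} → Unmatched (left i) → i ∈ S
    ∈S⁺ (Ri , σi) = ∈-tabulate⁺ (cong₂ _∧_ Ri (cong is-nothing σi))

    nbhd-partner : ∀ j → j ∈ nbhd E S → ∃ λ i → σ (right j) ≡ just (left i) × Unmatched (left i)
    nbhd-partner j j∈N with ∈-nbhd⁻ E S j∈N
    ... | i , i∈S , Eij with C2 (left i) (proj₁ (∈S⁻ i∈S)) (proj₂ (∈S⁻ i∈S)) (right j) Eij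
    ...   | Rj , σj≢⊥ with partner Rj σj≢⊥
    ...     | left i′ , σj , _  , i′-unmatched = i′ , σj , i′-unmatched
    ...     | right _ , _  , () , _
    ...     | v₁      , _  , () , _
    ...     | v₀      , _  , () , _

    nbhd-partner∈S-i₀ : ∀ j j∈N → proj₁ (nbhd-partner j j∈N) ∈ S - i₀
    nbhd-partner∈S-i₀ j j∈N with nbhd-partner j j∈N
    ... | i , σj , i-unmatched = x∈p∧x≢y⇒x∈p-y (∈S⁺ i-unmatched) i≢i₀
      where
      i≢i₀ : i ≢ i₀
      i≢i₀ refl with C3 (left i₀) (proj₁ i₀-unmatched) (right j) v₁ σj (proj₂ v₁-matched-left)
      ... | ()

    nbhd-partner-injective : ∀ j j′ j∈N j′∈N →
      proj₁ (nbhd-partner j j∈N) ≡ proj₁ (nbhd-partner j′ j′∈N) → j ≡ j′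
    nbhd-partner-injective j j′ j∈N j′∈N eq with nbhd-partner j j∈N | nbhd-partner j′ j′∈N
    nbhd-partner-injective j j′ j∈N j′∈N refl | i , σj , Ri , _ | .i , σj′ , _ =
      right-injective (C3 (left i) Ri (right j) (right j′) σj σj′)

    ∣nbhd∣<∣S∣ : ∣ nbhd E S ∣ < ∣ S ∣
    ∣nbhd∣<∣S∣ = ≤-<-trans
      (injectiveOn⇒∣p∣≤∣q∣ (λ j j∈N → proj₁ (nbhd-partner j j∈N))
        nbhd-partner∈S-i₀ nbhd-partner-injective)
      (x∈p⇒∣p-x∣<∣p∣ (∈S⁺ i₀-unmatched))

proposition2 : ∀ {m n} (E : BipGraph m n)
                 (R : Vert m n → Bool) (σ : Vert m n → Maybe (Vert m n)) →
                 IsAssignment E R σ →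
                 (σ v₀ ≢ nothing → Σ (Fin m → Fin n → Bool) (λ M → MatchingCovering E M))
                 × (σ v₀ ≡ nothing → Σ (Subset m) (λ S → ∣ nbhd E S ∣ < ∣ S ∣))
proposition2 E R σ A =
  (λ σv₀≢⊥ → let open Covering σv₀≢⊥ in matching , isMatchingCovering) ,
  (λ σv₀≡⊥ → let open Deficiency σv₀≡⊥ in S , ∣nbhd∣<∣S∣)
  where open Assignment E R σ A
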